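{- For every integer $n\geq 3$, there exists a strongly $2$-connected $(n-1)$-regular digraph on $2n$ vertices with no Hamilton cycle. For every integer $n \ge 3$, there exists a strongly $2$-connected $(n-1)$-regular oriented graph on $4n+2$ vertices with no Hamilton cycle.
   Context: A digraph is a finite directed graph without loops with at most one edge from $a$ to $b$ for each ordered pair of distinct vertices $(a,b)$; an oriented graph is a digraph with at most one edge between any two vertices. A digraph is $d$-regular if every vertex has exactly $d$ outneighbours and $d$ inneighbours. A digraph is strongly connected if for all vertices $u,v$ there is a directed path from $u$ to $v$; it is strongly $2$-connected if it has at least three vertices and deleting any single vertex leaves a strongly connected digraph. A Hamilton cycle is a directed cycle through all vertices. -}

module Defs where

open import Data.Nat using (ℕ; zero; suc; _≤_)
open import Data.Nat.DivMod using (_%_; m%n<n)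
open import Data.Fin using (Fin; toℕ; fromℕ<)
open import Data.Fin.Base using (zero; suc)
open import Data.Unit using (⊤)
open import Data.Bool using (Bool; true; false)
open import Data.List using (List; []; _∷_; length; filterᵇ; allFin)
open import Data.Product using (Σ; _×_)
open import Relation.Binary.PropositionalEquality using (_≡_; _≢_)
open import Relation.Nullary using (¬_)
open import Function.Definitions using (Injective)

-- At most one edge per
-- ordered pair is automatic; loops are excluded by the Loopless condition.
Adjacency : ℕ → Set
Adjacency m = Fin m → Fin m → Bool

Loopless : ∀ {m} → Adjacency m → Set
Loopless {m} A = (v : Fin m) → A v v ≡ false

record Digraph (m : ℕ) : Set where
  field
    adj      : Adjacency m
    loopless : Loopless adj
open Digraph public

Oriented : ∀ {m} → Digraph m → Set
Oriented {m} G = (u v : Fin m) → adj G u v ≡ true → adj G v u ≡ false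

outDeg : ∀ {m} → Digraph m → Fin m → ℕ
outDeg {m} G v = length (filterᵇ (λ w → adj G v w) (allFin m))

inDeg : ∀ {m} → Digraph m → Fin m → ℕ
inDeg {m} G v = length (filterᵇ (λ w → adj G w v) (allFin m))

Regular : ∀ {m} → ℕ → Digraph m → Set
Regular {m} d G = (v : Fin m) → (outDeg G v ≡ d) × (inDeg G v ≡ d)

data WalkIn {m} (G : Digraph m) (P : Fin m → Set) : Fin m → Fin m → Set where
  here : ∀ {u} → P u → WalkIn G P u u
  step : ∀ {u w v} → P u → adj G u w ≡ true → WalkIn G P w v → WalkIn G P u v

StronglyConnected : ∀ {m} → Digraph m → Set
StronglyConnected {m} G = (u v : Fin m) → WalkIn G (λ _ → ⊤) u v

Strongly2Connected : ∀ {m} → Digraph m → Set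
Strongly2Connected {m} G =
  (3 ≤ m) ×
  ((x u v : Fin m) → u ≢ x → v ≢ x → WalkIn G (λ w → w ≢ x) u v)

next : ∀ {m} → Fin m → Fin m
next {suc k} i = fromℕ< (m%n<n (suc (toℕ i)) (suc k))

HamiltonCycle : ∀ {m} → Digraph m → Set
HamiltonCycle {m} G =
  Σ (Fin m → Fin m) λ c → Injective _≡_ _≡_ c × ((i : Fin m) → adj G (c i) (c (next i)) ≡ true)

-- Both graphs are twins of a gadget H: two copies A and B of a digraph H in which two ports
-- 0 and 1 have in- and out-degree d - 1 and all other vertices degree d, joined by the cross
-- edges A i → B i and B i → A (1 - i). The cross edges make the twin d-regular. After deleting
-- a vertex, every vertex still reaches a port of its own copy and is reached from one, and the
-- cross edges link the copies, so the twin is strongly 2-connected. A Hamilton cycle is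
-- impossible: its successor map would have a single orbit, yet depending on which cross edges
-- it uses, one of the sets "a copy", "a copy plus one vertex" or "the four ports" is closed
-- under it. For digraphs H is the complete digraph on n vertices without the two edges between
-- the ports; for oriented graphs H is the circulant on 2n + 1 vertices with i → i + 1, …,
-- i + n - 1, in which 0 → 1, 1 → 2 and n + 3 → 0 are replaced by n + 3 → 2.

module Submission where

open import Defs
open import Data.Nat using (ℕ; zero; suc; _+_; _∸_; _*_; _≤_; _<_; _<ᵇ_; _≤ᵇ_; _≡ᵇ_; z≤n; s≤s)
open import Data.Nat.Properties
open import Data.Nat.DivMod using (_%_; %-distribˡ-+; m%n%n≡m%n; m<n⇒m%n≡m; [m+n]%n≡m%n)
open import Data.Nat.GeneralisedArithmetic using (fold)
open import Data.Nat.Tactic.RingSolver using (solve-∀)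
open import Data.Fin using (Fin; toℕ; fromℕ<; zero; suc; splitAt; join; _↑ˡ_; _↑ʳ_)
open import Data.Fin.Base using (punchOut)
open import Data.Fin.Properties
  using (toℕ-injective; toℕ<n; toℕ-fromℕ<; pigeonhole; punchOut-injective; any?;
         splitAt-join; join-splitAt; splitAt-↑ˡ; splitAt-↑ʳ)
  renaming (_≟_ to _≟ᶠ_)
open import Data.Bool using (Bool; true; false; not; _∧_; _∨_; T)
open import Data.Bool.Properties using (∨-zeroʳ; ∨-identityʳ; ∧-zeroʳ; ∧-identityʳ; T-∧; T-∨; T-≡)
open import Data.List using (length; filterᵇ; tabulate)
open import Data.Sum using (_⊎_; inj₁; inj₂; [_,_])
import Data.Sum as Sum
open import Data.Sum.Properties using (inj₁-injective; inj₂-injective)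
open import Data.Product using (Σ; ∃; _×_; _,_; proj₁; proj₂)
import Data.Product as Product
open import Data.Empty using (⊥; ⊥-elim)
open import Data.Unit using (⊤; tt)
open import Function using (_∘_; id)
open import Function.Bundles using (Equivalence)
open import Function.Definitions using (Injective)
open import Relation.Nullary using (¬_; yes; no; contradiction)
open import Relation.Binary.PropositionalEquality hiding ([_])

T⇒≡true : ∀ {b} → T b → b ≡ true
T⇒≡true {true} _ = refl

¬T⇒≡false : ∀ {b} → ¬ T b → b ≡ false
¬T⇒≡false {false} _  = refl
¬T⇒≡false {true}  ¬t with ¬t tt
... | ()

<ᵇ-true : ∀ {m n} → m < n → (m <ᵇ n) ≡ true
<ᵇ-true = T⇒≡true ∘ <⇒<ᵇ

<ᵇ-false : ∀ {m n} → n ≤ m → (m <ᵇ n) ≡ false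
<ᵇ-false {m} {n} n≤m = ¬T⇒≡false (λ t → <⇒≱ (<ᵇ⇒< m n t) n≤m)

≡ᵇ-true : ∀ m → (m ≡ᵇ m) ≡ true
≡ᵇ-true m = T⇒≡true (≡⇒≡ᵇ m m refl)

≡ᵇ-false : ∀ {m n} → m ≢ n → (m ≡ᵇ n) ≡ false
≡ᵇ-false {m} {n} m≢n = ¬T⇒≡false (m≢n ∘ ≡ᵇ⇒≡ m n)

∧-false : ∀ {P Q : Set} {a b} → (T a → P) → (T b → Q) → ¬ (P × Q) → a ∧ b ≡ false
∧-false {a = false}              _   _   _   = refl
∧-false {a = true}  {b = false}  _   _   _   = refl
∧-false {a = true}  {b = true}   a⇒P b⇒Q ¬PQ with ¬PQ (a⇒P _ , b⇒Q _)
... | ()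

boolToℕ : Bool → ℕ
boolToℕ true  = 1
boolToℕ false = 0

count : (ℕ → Bool) → ℕ → ℕ
count p zero    = 0
count p (suc m) = boolToℕ (p 0) + count (p ∘ suc) m

count-cong : ∀ m {p q : ℕ → Bool} → (∀ i → i < m → p i ≡ q i) → count p m ≡ count q m
count-cong zero    eq = refl
count-cong (suc m) eq = cong₂ _+_ (cong boolToℕ (eq 0 (s≤s z≤n))) (count-cong m (λ i i<m → eq (suc i) (s≤s i<m)))

count-+ : ∀ a b (p : ℕ → Bool) → count p (a + b) ≡ count p a + count (λ j → p (a + j)) b
count-+ zero    b p = refl
count-+ (suc a) b p = trans (cong (boolToℕ (p 0) +_) (count-+ a b (p ∘ suc))) (sym (+-assoc (boolToℕ (p 0)) _ _))

count-snoc : ∀ m (p : ℕ → Bool) → count p (suc m) ≡ count p m + boolToℕ (p m)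
count-snoc zero    p = +-comm (boolToℕ (p 0)) 0
count-snoc (suc m) p = trans (cong (boolToℕ (p 0) +_) (count-snoc m (p ∘ suc))) (sym (+-assoc (boolToℕ (p 0)) _ _))

count-none : ∀ m (p : ℕ → Bool) → (∀ i → i < m → p i ≡ false) → count p m ≡ 0
count-none zero    p none = refl
count-none (suc m) p none rewrite none 0 (s≤s z≤n) = count-none m (p ∘ suc) (λ i i<m → none (suc i) (s≤s i<m))

count-all : ∀ m (p : ℕ → Bool) → (∀ i → i < m → p i ≡ true) → count p m ≡ m
count-all zero    p all = refl
count-all (suc m) p all rewrite all 0 (s≤s z≤n) = cong suc (count-all m (p ∘ suc) (λ i i<m → all (suc i) (s≤s i<m)))

count-window : ∀ m lo c (p : ℕ → Bool) → lo + c ≤ m →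
               (∀ i → i < lo → p i ≡ false) →
               (∀ i → lo ≤ i → i < lo + c → p i ≡ true) →
               (∀ i → lo + c ≤ i → i < m → p i ≡ false) →
               count p m ≡ c
count-window m lo c p lo+c≤m below inside above = begin
  count p m                                                ≡⟨ cong (count p) m≡ ⟨
  count p (lo + (c + r))                                   ≡⟨ count-+ lo (c + r) p ⟩
  count p lo + count (λ j → p (lo + j)) (c + r)            ≡⟨ cong₂ _+_ (count-none lo p below) (count-+ c r _) ⟩
  count (λ j → p (lo + j)) c + count (λ j → p (lo + (c + j))) r
      ≡⟨ cong₂ _+_ (count-all c _ (λ i i<c → inside _ (m≤m+n lo i) (+-monoʳ-< lo i<c)))
                   (count-none r _ (λ i i<r → above _ (subst (lo + c ≤_) (+-assoc lo c i) (m≤m+n (lo + c) i))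
                                                      (subst₂ _<_ (+-assoc lo c i) m≡′ (+-monoʳ-< (lo + c) i<r)))) ⟩
  c + 0                                                    ≡⟨ +-identityʳ c ⟩
  c                                                        ∎
  where
  open ≡-Reasoning
  r = m ∸ (lo + c)
  m≡′ : lo + c + r ≡ m
  m≡′ = m+[n∸m]≡n lo+c≤m
  m≡ : lo + (c + r) ≡ m
  m≡ = trans (sym (+-assoc lo c r)) m≡′

count-insert : ∀ m a (p q : ℕ → Bool) → a < m → p a ≡ true → q a ≡ false →
               (∀ i → i < m → i ≢ a → p i ≡ q i) → count p m ≡ suc (count q m)
count-insert (suc m) zero    p q a<m pa qa agree rewrite pa | qa =
  cong suc (count-cong m (λ i i<m → agree (suc i) (s≤s i<m) (λ ())))
count-insert (suc m) (suc a) p q (s≤s a<m) pa qa agree rewrite agree 0 (s≤s z≤n) (λ ()) =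
  trans (cong (boolToℕ (q 0) +_) (count-insert m a (p ∘ suc) (q ∘ suc) a<m pa qa
                                    (λ i i<m i≢a → agree (suc i) (s≤s i<m) (i≢a ∘ suc-injective))))
        (+-suc (boolToℕ (q 0)) _)

count-all-but : ∀ m a (p : ℕ → Bool) → a < m → p a ≡ false →
                (∀ i → i < m → i ≢ a → p i ≡ true) → suc (count p m) ≡ m
count-all-but m a p a<m pa others =
  trans (sym (count-insert m a (λ _ → true) p a<m refl pa (λ i i<m i≢a → sym (others i i<m i≢a))))
        (count-all m (λ _ → true) (λ _ _ → refl))

count-first-two : ∀ r (p : ℕ → Bool) → (∀ j → p (2 + j) ≡ false) →
                  count p (2 + r) ≡ boolToℕ (p 0) + boolToℕ (p 1)
count-first-two r p rest =
  cong (boolToℕ (p 0) +_) (trans (cong (boolToℕ (p 1) +_) (count-none r _ (λ j _ → rest j))) (+-identityʳ _))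

count-move : ∀ m a b (p q : ℕ → Bool) → a < m → b < m →
             p a ≡ true → q a ≡ false → p b ≡ false → q b ≡ true →
             (∀ i → i < m → i ≢ a → i ≢ b → p i ≡ q i) → count p m ≡ count q m
count-move m a b p q a<m b<m pa qa pb qb agree =
  trans (count-insert m a p r a<m pa ra (λ i _ i≢a → sym (r-off i≢a)))
        (sym (count-insert m b q r b<m qb rb q≡r))
  where
  r : ℕ → Bool
  r i = p i ∧ not (i ≡ᵇ a)
  ra : r a ≡ false
  ra rewrite ≡ᵇ-true a = ∧-zeroʳ (p a)
  r-off : ∀ {i} → i ≢ a → r i ≡ p i
  r-off {i} i≢a rewrite ≡ᵇ-false i≢a = ∧-identityʳ (p i)
  rb : r b ≡ false
  rb rewrite pb = refl
  q≡r : ∀ i → i < m → i ≢ b → q i ≡ r i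
  q≡r i i<m i≢b with i ≟ a
  ... | yes refl = trans qa (sym ra)
  ... | no  i≢a  = trans (sym (agree i i<m i≢a i≢b)) (sym (r-off i≢a))

count-rotate : ∀ m (p q : ℕ → Bool) → q 0 ≡ p m → (∀ j → j < m → q (suc j) ≡ p j) →
               count q (suc m) ≡ count p (suc m)
count-rotate m p q q0 qsuc = begin
  boolToℕ (q 0) + count (q ∘ suc) m ≡⟨ cong₂ _+_ (cong boolToℕ q0) (count-cong m qsuc) ⟩
  boolToℕ (p m) + count p m         ≡⟨ +-comm (boolToℕ (p m)) _ ⟩
  count p m + boolToℕ (p m)         ≡⟨ count-snoc m p ⟨
  count p (suc m)                   ∎
  where open ≡-Reasoning

countFin : ∀ {m} → (Fin m → Bool) → ℕ
countFin {zero}  p = 0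
countFin {suc m} p = boolToℕ (p zero) + countFin (p ∘ suc)

length-filterᵇ-tabulate : ∀ {m} {A : Set} (q : A → Bool) (f : Fin m → A) →
                          length (filterᵇ q (tabulate f)) ≡ countFin (q ∘ f)
length-filterᵇ-tabulate {zero}  q f = refl
length-filterᵇ-tabulate {suc m} q f with q (f zero)
... | true  = cong suc (length-filterᵇ-tabulate q (f ∘ suc))
... | false = length-filterᵇ-tabulate q (f ∘ suc)

countFin-+ : ∀ a b (p : Fin (a + b) → Bool) → countFin p ≡ countFin (p ∘ (_↑ˡ b)) + countFin (p ∘ (a ↑ʳ_))
countFin-+ zero    b p = refl
countFin-+ (suc a) b p =
  trans (cong (boolToℕ (p zero) +_) (countFin-+ a b (p ∘ suc))) (sym (+-assoc (boolToℕ (p zero)) _ _))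

countFin-toℕ : ∀ {m} (p : Fin m → Bool) (P : ℕ → Bool) → (∀ i → p i ≡ P (toℕ i)) →
               countFin p ≡ count P m
countFin-toℕ {zero}  p P eq = refl
countFin-toℕ {suc m} p P eq = cong₂ _+_ (cong boolToℕ (eq zero)) (countFin-toℕ (p ∘ suc) (P ∘ suc) (eq ∘ suc))

countFin-cong : ∀ {m} {p q : Fin m → Bool} → (∀ i → p i ≡ q i) → countFin p ≡ countFin q
countFin-cong {zero}  eq = refl
countFin-cong {suc m} eq = cong₂ _+_ (cong boolToℕ (eq zero)) (countFin-cong (eq ∘ suc))

SingleOrbit : ∀ {A : Set} → (A → A) → Set₁
SingleOrbit {A} σ = (X : A → Set) → (∀ a → X a → X (σ a)) → ∀ a → X a → ∀ b → X b

singleOrbit-conj : ∀ {A B : Set} {σ : A → A} (f : A → B) (g : B → A) →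
                   (∀ a → g (f a) ≡ a) → (∀ b → f (g b) ≡ b) → SingleOrbit σ → SingleOrbit (f ∘ σ ∘ g)
singleOrbit-conj {σ = σ} f g gf fg orbit X closed b Xb b′ =
  subst X (fg b′) (orbit (X ∘ f) closed′ (g b) (subst X (sym (fg b)) Xb) (g b′))
  where
  closed′ : ∀ a → X (f a) → X (f (σ a))
  closed′ a Xfa = subst (λ a′ → X (f (σ a′))) (gf a) (closed (f a) Xfa)

injective⇒surjective : ∀ {m} (f : Fin m → Fin m) → Injective _≡_ _≡_ f → ∀ v → ∃ λ i → f i ≡ v
injective⇒surjective {zero}  f inj ()
injective⇒surjective {suc m} f inj v with any? (λ i → f i ≟ᶠ v)
... | yes hit = hit
... | no miss with pigeonhole (n<1+n m) (λ j → punchOut {i = v} {j = f j} (miss ∘ (j ,_) ∘ sym))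
... | i , j , i<j , eq =
  ⊥-elim (<⇒≢ i<j (cong toℕ (inj (punchOut-injective (miss ∘ (i ,_) ∘ sym) (miss ∘ (j ,_) ∘ sym) eq))))

toℕ-fold-next : ∀ {m} t (i : Fin (suc m)) → toℕ (fold i next t) ≡ (toℕ i + t) % suc m
toℕ-fold-next {m} zero    i = sym (trans (cong (_% suc m) (+-identityʳ (toℕ i))) (m<n⇒m%n≡m (toℕ<n i)))
toℕ-fold-next {m} (suc t) i = begin
  toℕ (next (fold i next t))        ≡⟨ toℕ-fromℕ< _ ⟩
  suc (toℕ (fold i next t)) % M     ≡⟨ cong (λ z → suc z % M) (toℕ-fold-next t i) ⟩
  (1 + (toℕ i + t) % M) % M            ≡⟨ %-distribˡ-+ 1 ((toℕ i + t) % M) M ⟩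
  (1 % M + (toℕ i + t) % M % M) % M    ≡⟨ cong (λ z → (1 % M + z) % M) (m%n%n≡m%n (toℕ i + t) M) ⟩
  (1 % M + (toℕ i + t) % M) % M        ≡⟨ sym (%-distribˡ-+ 1 (toℕ i + t) M) ⟩
  (1 + (toℕ i + t)) % M                ≡⟨ cong (_% M) (sym (+-suc (toℕ i) t)) ⟩
  (toℕ i + suc t) % M                  ∎
  where
  open ≡-Reasoning
  M = suc m

next-reaches : ∀ {m} (i j : Fin (suc m)) → ∃ λ t → fold i next t ≡ j
next-reaches {m} i j = t , toℕ-injective (begin
  toℕ (fold i next t)                   ≡⟨ toℕ-fold-next t i ⟩
  (toℕ i + ((M ∸ toℕ i) + toℕ j)) % M      ≡⟨ cong (_% M) (sym (+-assoc (toℕ i) (M ∸ toℕ i) (toℕ j))) ⟩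
  (toℕ i + (M ∸ toℕ i) + toℕ j) % M        ≡⟨ cong (λ z → (z + toℕ j) % M) (m+[n∸m]≡n (<⇒≤ (toℕ<n i))) ⟩
  (M + toℕ j) % M                          ≡⟨ cong (_% M) (+-comm M (toℕ j)) ⟩
  (toℕ j + M) % M                          ≡⟨ [m+n]%n≡m%n (toℕ j) M ⟩
  toℕ j % M                                ≡⟨ m<n⇒m%n≡m (toℕ<n j) ⟩
  toℕ j                                    ∎)
  where
  open ≡-Reasoning
  M = suc m
  t = (M ∸ toℕ i) + toℕ j

next-singleOrbit : ∀ {m} → SingleOrbit (next {m})
next-singleOrbit {zero}  X closed ()
next-singleOrbit {suc m} X closed i Xi j with next-reaches i j
... | t , refl = along t
  where
  along : ∀ t → X (fold i next t)
  along zero    = Xi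
  along (suc t) = closed _ (along t)

hamiltonCycle⇒successor : ∀ {m} (G : Digraph m) → HamiltonCycle G →
  Σ (Fin m → Fin m) λ σ → (∀ v → adj G v (σ v) ≡ true) × SingleOrbit σ
hamiltonCycle⇒successor {m} G (c , inj , edges) = σ , σ-edge , σ-orbit
  where
  position : ∀ v → ∃ λ i → c i ≡ v
  position = injective⇒surjective c inj

  pos : Fin m → Fin m
  pos v = proj₁ (position v)

  σ : Fin m → Fin m
  σ v = c (next (pos v))

  σ-edge : ∀ v → adj G v (σ v) ≡ true
  σ-edge v = subst (λ u → adj G u (σ v) ≡ true) (proj₂ (position v)) (edges (pos v))

  σ-orbit : SingleOrbit σ
  σ-orbit = singleOrbit-conj c pos (λ i → inj (proj₂ (position (c i)))) (proj₂ ∘ position) next-singleOrbit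

data Walk (h : ℕ → ℕ → Bool) (Q : ℕ → Set) : ℕ → ℕ → Set where
  here : ∀ {u} → Q u → Walk h Q u u
  step : ∀ {u w v} → Q u → h u w ≡ true → Walk h Q w v → Walk h Q u v

walk-++ : ∀ {h Q u w v} → Walk h Q u w → Walk h Q w v → Walk h Q u v
walk-++ (here _)       q = q
walk-++ (step qu e p) q = step qu e (walk-++ p q)

walk-map : ∀ {h Q Q′ u v} → (∀ {w} → Q w → Q′ w) → Walk h Q u v → Walk h Q′ u v
walk-map f (here q)       = here (f q)
walk-map f (step q e p) = step (f q) e (walk-map f p)

walk-head : ∀ {h Q u v} → Walk h Q u v → Q u
walk-head (here q)     = q
walk-head (step q _ _) = q

walkIn-++ : ∀ {m} {G : Digraph m} {P u w v} → WalkIn G P u w → WalkIn G P w v → WalkIn G P u v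
walkIn-++ (here _)       q = q
walkIn-++ (step pu e p) q = step pu e (walkIn-++ p q)

walkIn-map : ∀ {m} {G : Digraph m} {P P′ u v} → (∀ {w} → P w → P′ w) → WalkIn G P u v → WalkIn G P′ u v
walkIn-map f (here p)       = here (f p)
walkIn-map f (step p e q) = step (f p) e (walkIn-map f q)

Avoiding : ℕ → ℕ → ℕ → Set
Avoiding k x w = w < k × w ≢ x

-- h is an adjacency relation on the vertices 0, …, 2 + r; the ports 0 and 1 are where the
-- cross edges of the twin attach.
record Gadget (r d : ℕ) (h : ℕ → ℕ → Bool) : Set where
  field
    irreflexive : ∀ i → h i i ≡ false
    out-degree  : ∀ i → i < 3 + r → count (h i) (3 + r) + boolToℕ (i <ᵇ 2) ≡ d
    in-degree   : ∀ j → j < 3 + r → count (λ i → h i j) (3 + r) + boolToℕ (j <ᵇ 2) ≡ d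
    to-port     : ∀ x u → u < 3 + r → u ≢ x →
                  Σ (Fin 2) λ i → toℕ i ≢ x × Walk h (Avoiding (3 + r) x) u (toℕ i)
    from-port   : ∀ x v → v < 3 + r → v ≢ x →
                  Σ (Fin 2) λ i → toℕ i ≢ x × Walk h (Avoiding (3 + r) x) (toℕ i) v
    port₀⇝port₁ : Walk h (_< 3 + r) 0 1
    port₁⇝port₀ : Walk h (_< 3 + r) 1 0

  -- Deleting x = 3 + r deletes nothing.
  walk-within : ∀ {a b} → a < 3 + r → b < 3 + r → Walk h (_< 3 + r) a b
  walk-within {a} {b} a<k b<k with to-port (3 + r) a a<k (<⇒≢ a<k) | from-port (3 + r) b b<k (<⇒≢ b<k)
  ... | i , _ , a⇝i | j , _ , j⇝b = walk-++ (walk-map proj₁ a⇝i) (walk-++ (between i j) (walk-map proj₁ j⇝b))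
    where
    between : ∀ i j → Walk h (_< 3 + r) (toℕ i) (toℕ j)
    between zero       zero       = here (s≤s z≤n)
    between zero       (suc zero) = port₀⇝port₁
    between (suc zero) zero       = port₁⇝port₀
    between (suc zero) (suc zero) = here (s≤s (s≤s z≤n))

straight : ℕ → ℕ → Bool
straight 0 0 = true
straight 1 1 = true
straight _ _ = false

twisted : ℕ → ℕ → Bool
twisted 0 1 = true
twisted 1 0 = true
twisted _ _ = false

twinEdge : ∀ {k} → (ℕ → ℕ → Bool) → Fin k ⊎ Fin k → Fin k ⊎ Fin k → Bool
twinEdge h (inj₁ a) (inj₁ b) = h (toℕ a) (toℕ b)
twinEdge h (inj₁ a) (inj₂ b) = straight (toℕ a) (toℕ b)
twinEdge h (inj₂ a) (inj₁ b) = twisted (toℕ a) (toℕ b)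
twinEdge h (inj₂ a) (inj₂ b) = h (toℕ a) (toℕ b)

twinEdge-irreflexive : ∀ {k} {h : ℕ → ℕ → Bool} → (∀ i → h i i ≡ false) →
                       ∀ (x : Fin k ⊎ Fin k) → twinEdge h x x ≡ false
twinEdge-irreflexive irreflexive (inj₁ a) = irreflexive (toℕ a)
twinEdge-irreflexive irreflexive (inj₂ a) = irreflexive (toℕ a)

twin : ∀ r (h : ℕ → ℕ → Bool) → (∀ i → h i i ≡ false) → Digraph ((3 + r) + (3 + r))
twin r h irreflexive = record
  { adj      = λ u v → twinEdge h (splitAt (3 + r) u) (splitAt (3 + r) v)
  ; loopless = twinEdge-irreflexive irreflexive ∘ splitAt (3 + r)
  }

twin-adj-join : ∀ {r h} irreflexive (x y : Fin (3 + r) ⊎ Fin (3 + r)) →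
                adj (twin r h irreflexive) (join _ _ x) (join _ _ y) ≡ twinEdge h x y
twin-adj-join {r} _ x y rewrite splitAt-join (3 + r) (3 + r) x | splitAt-join (3 + r) (3 + r) y = refl

straight-twisted : ∀ i j → straight i j ≡ true → twisted j i ≡ false
straight-twisted 0 0 _ = refl
straight-twisted 1 1 _ = refl
straight-twisted 0 (suc j) ()
straight-twisted 1 0 ()
straight-twisted 1 (suc (suc j)) ()
straight-twisted (suc (suc i)) j ()

twisted-straight : ∀ i j → twisted i j ≡ true → straight j i ≡ false
twisted-straight 0 1 _ = refl
twisted-straight 1 0 _ = refl
twisted-straight 0 0 ()
twisted-straight 0 (suc (suc j)) ()
twisted-straight 1 (suc j) ()
twisted-straight (suc (suc i)) j ()

twin-oriented : ∀ {r h} irreflexive → (∀ i j → h i j ≡ true → h j i ≡ false) → Oriented (twin r h irreflexive)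
twin-oriented {r} {h} _ antisym u v = oriented (splitAt (3 + r) u) (splitAt (3 + r) v)
  where
  oriented : ∀ x y → twinEdge h x y ≡ true → twinEdge h y x ≡ false
  oriented (inj₁ a) (inj₁ b) = antisym (toℕ a) (toℕ b)
  oriented (inj₁ a) (inj₂ b) = straight-twisted (toℕ a) (toℕ b)
  oriented (inj₂ a) (inj₁ b) = twisted-straight (toℕ a) (toℕ b)
  oriented (inj₂ a) (inj₂ b) = antisym (toℕ a) (toℕ b)

onSide : ∀ {k} → Bool → Fin k → Fin k ⊎ Fin k
onSide true  = inj₁
onSide false = inj₂

onSide-≢ : ∀ {k} s {a c : Fin k} → a ≢ c → onSide s a ≢ onSide s c
onSide-≢ true  a≢c = a≢c ∘ inj₁-injective
onSide-≢ false a≢c = a≢c ∘ inj₂-injective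

sides-differ : ∀ {k} s {a c : Fin k} → onSide s a ≢ onSide (not s) c
sides-differ true  ()
sides-differ false ()

twinEdge-within : ∀ {k} {h : ℕ → ℕ → Bool} s (a b : Fin k) →
                  twinEdge h (onSide s a) (onSide s b) ≡ h (toℕ a) (toℕ b)
twinEdge-within true  a b = refl
twinEdge-within false a b = refl

port : ∀ {r} → Fin 2 → Fin (3 + r)
port zero       = zero
port (suc zero) = suc zero

toℕ-port : ∀ {r} i → toℕ (port {r} i) ≡ toℕ i
toℕ-port zero       = refl
toℕ-port (suc zero) = refl

exitPort : Bool → Fin 2 → Fin 2
exitPort true  i          = i
exitPort false zero       = suc zero
exitPort false (suc zero) = zero

cross-out : ∀ {r} {h : ℕ → ℕ → Bool} s i →
            twinEdge {3 + r} h (onSide s (port i)) (onSide (not s) (port (exitPort s i))) ≡ true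
cross-out true  zero       = refl
cross-out true  (suc zero) = refl
cross-out false zero       = refl
cross-out false (suc zero) = refl

cross-in : ∀ {r} {h : ℕ → ℕ → Bool} s i →
           twinEdge {3 + r} h (onSide (not s) (port (exitPort (not s) i))) (onSide s (port i)) ≡ true
cross-in true  zero       = refl
cross-in true  (suc zero) = refl
cross-in false zero       = refl
cross-in false (suc zero) = refl

straight-row : ∀ r i → count (straight i) (3 + r) ≡ boolToℕ (i <ᵇ 2)
straight-row r 0             = count-first-two (suc r) (straight 0) (λ _ → refl)
straight-row r 1             = count-first-two (suc r) (straight 1) (λ _ → refl)
straight-row r (suc (suc i)) = count-first-two (suc r) (straight (suc (suc i))) (λ _ → refl)

straight-column : ∀ r j → count (λ i → straight i j) (3 + r) ≡ boolToℕ (j <ᵇ 2)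
straight-column r 0             = count-first-two (suc r) (λ i → straight i 0) (λ _ → refl)
straight-column r 1             = count-first-two (suc r) (λ i → straight i 1) (λ _ → refl)
straight-column r (suc (suc j)) = count-first-two (suc r) (λ i → straight i (suc (suc j))) (λ _ → refl)

twisted-row : ∀ r i → count (twisted i) (3 + r) ≡ boolToℕ (i <ᵇ 2)
twisted-row r 0             = count-first-two (suc r) (twisted 0) (λ _ → refl)
twisted-row r 1             = count-first-two (suc r) (twisted 1) (λ _ → refl)
twisted-row r (suc (suc i)) = count-first-two (suc r) (twisted (suc (suc i))) (λ _ → refl)

twisted-column : ∀ r j → count (λ i → twisted i j) (3 + r) ≡ boolToℕ (j <ᵇ 2)
twisted-column r 0             = count-first-two (suc r) (λ i → twisted i 0) (λ _ → refl)
twisted-column r 1             = count-first-two (suc r) (λ i → twisted i 1) (λ _ → refl)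
twisted-column r (suc (suc j)) = count-first-two (suc r) (λ i → twisted i (suc (suc j))) (λ _ → refl)

countFin-splitAt : ∀ k (f : Fin k ⊎ Fin k → Bool) →
                   countFin (f ∘ splitAt k) ≡ countFin (f ∘ inj₁) + countFin (f ∘ inj₂)
countFin-splitAt k f = trans (countFin-+ k k (f ∘ splitAt k))
  (cong₂ _+_ (countFin-cong (λ j → cong f (splitAt-↑ˡ k j k))) (countFin-cong (λ j → cong f (splitAt-↑ʳ k k j))))

module _ {r d : ℕ} {h : ℕ → ℕ → Bool} (g : Gadget r d h) where
  open Gadget g

  private
    k = 3 + r

    count-pair : ∀ (p q : Fin k → Bool) P Q → (∀ i → p i ≡ P (toℕ i)) → (∀ i → q i ≡ Q (toℕ i)) →
                 countFin p + countFin q ≡ count P k + count Q k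
    count-pair p q P Q p≡ q≡ = cong₂ _+_ (countFin-toℕ p P p≡) (countFin-toℕ q Q q≡)

    out-twin : ∀ x → countFin (twinEdge h x ∘ inj₁) + countFin (twinEdge h x ∘ inj₂) ≡ d
    out-twin (inj₁ a) =
      trans (count-pair _ _ (h (toℕ a)) (straight (toℕ a)) (λ _ → refl) (λ _ → refl))
            (trans (cong (count (h (toℕ a)) k +_) (straight-row r (toℕ a))) (out-degree (toℕ a) (toℕ<n a)))
    out-twin (inj₂ a) =
      trans (count-pair _ _ (twisted (toℕ a)) (h (toℕ a)) (λ _ → refl) (λ _ → refl))
            (trans (+-comm (count (twisted (toℕ a)) k) _)
                   (trans (cong (count (h (toℕ a)) k +_) (twisted-row r (toℕ a))) (out-degree (toℕ a) (toℕ<n a))))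

    in-twin : ∀ y → countFin ((λ x → twinEdge h x y) ∘ inj₁) + countFin ((λ x → twinEdge h x y) ∘ inj₂) ≡ d
    in-twin (inj₁ b) =
      trans (count-pair _ _ (λ i → h i (toℕ b)) (λ i → twisted i (toℕ b)) (λ _ → refl) (λ _ → refl))
            (trans (cong (count (λ i → h i (toℕ b)) k +_) (twisted-column r (toℕ b))) (in-degree (toℕ b) (toℕ<n b)))
    in-twin (inj₂ b) =
      trans (count-pair _ _ (λ i → straight i (toℕ b)) (λ i → h i (toℕ b)) (λ _ → refl) (λ _ → refl))
            (trans (+-comm (count (λ i → straight i (toℕ b)) k) _)
                   (trans (cong (count (λ i → h i (toℕ b)) k +_) (straight-column r (toℕ b)))
                          (in-degree (toℕ b) (toℕ<n b))))

  twin-regular : Regular d (twin r h irreflexive)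
  twin-regular v =
    trans (length-filterᵇ-tabulate (adj (twin r h irreflexive) v) id)
          (trans (countFin-splitAt k (twinEdge h (splitAt k v))) (out-twin (splitAt k v))) ,
    trans (length-filterᵇ-tabulate (λ u → adj (twin r h irreflexive) u v) id)
          (trans (countFin-splitAt k (λ x → twinEdge h x (splitAt k v))) (in-twin (splitAt k v)))

  private
    G = twin r h irreflexive

    Avoid : Fin k ⊎ Fin k → Fin (k + k) → Set
    Avoid x w = splitAt k w ≢ x

    avoid-join : ∀ {x y} → y ≢ x → Avoid x (join k k y)
    avoid-join {x} {y} y≢x eq = y≢x (trans (sym (splitAt-join k k y)) eq)

    edge : ∀ x y → twinEdge h x y ≡ true → adj G (join k k x) (join k k y) ≡ true
    edge x y = trans (twin-adj-join irreflexive x y)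

    lift : ∀ s {Q : ℕ → Set} {P : Fin (k + k) → Set} {i j} → Walk h Q i j →
           (∀ {w} → Q w → w < k) → (∀ a → Q (toℕ a) → P (join k k (onSide s a))) →
           ∀ {a b} → toℕ a ≡ i → toℕ b ≡ j → WalkIn G P (join k k (onSide s a)) (join k k (onSide s b))
    lift s (here q) bound inP {a} refl b≡a =
      subst (λ b → WalkIn G _ _ (join k k (onSide s b))) (toℕ-injective (sym b≡a)) (here (inP a q))
    lift s (step q e w) bound inP {a} refl b≡ =
      step (inP a q)
           (edge (onSide s a) (onSide s c)
                 (trans (twinEdge-within {h = h} s a c) (subst (λ t → h (toℕ a) t ≡ true) (sym c≡) e)))
           (lift s w bound inP c≡ b≡)
      where
      c = fromℕ< (bound (walk-head w))
      c≡ = toℕ-fromℕ< (bound (walk-head w))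

    inside : ∀ s a b {c} → WalkIn G (Avoid (onSide (not s) c)) (join k k (onSide s a)) (join k k (onSide s b))
    inside s a b = lift s (walk-within (toℕ<n a) (toℕ<n b)) id (λ _ _ → avoid-join (sides-differ s)) refl refl

    leave : ∀ s {a c} → a ≢ c →
            ∃ λ b → WalkIn G (Avoid (onSide s c)) (join k k (onSide s a)) (join k k (onSide (not s) b))
    leave s {a} {c} a≢c with to-port (toℕ c) (toℕ a) (toℕ<n a) (a≢c ∘ toℕ-injective)
    ... | i , i≢c , a⇝i = port (exitPort s i) ,
      walkIn-++ (lift s a⇝i proj₁ (λ _ q → avoid-join (onSide-≢ s (proj₂ q ∘ cong toℕ))) refl (toℕ-port i))
                (step (avoid-join (onSide-≢ s (i≢c ∘ trans (sym (toℕ-port i)) ∘ cong toℕ)))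
                      (edge (onSide s (port i)) (onSide (not s) (port (exitPort s i))) (cross-out s i))
                      (here (avoid-join (sides-differ s ∘ sym))))

    arrive : ∀ s {b c} → b ≢ c →
             ∃ λ a → WalkIn G (Avoid (onSide s c)) (join k k (onSide (not s) a)) (join k k (onSide s b))
    arrive s {b} {c} b≢c with from-port (toℕ c) (toℕ b) (toℕ<n b) (b≢c ∘ toℕ-injective)
    ... | i , i≢c , i⇝b = port (exitPort (not s) i) ,
      step (avoid-join (sides-differ s ∘ sym))
           (edge (onSide (not s) (port (exitPort (not s) i))) (onSide s (port i)) (cross-in s i))
           (lift s i⇝b proj₁ (λ _ q → avoid-join (onSide-≢ s (proj₂ q ∘ cong toℕ))) (toℕ-port i) refl)

    connected-avoiding : ∀ x u v → u ≢ x → v ≢ x → WalkIn G (Avoid x) (join k k u) (join k k v)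
    connected-avoiding (inj₁ c) (inj₁ a) (inj₁ b) u≢x v≢x =
      let (a′ , u⇝) = leave true (u≢x ∘ cong inj₁); (b′ , ⇝v) = arrive true (v≢x ∘ cong inj₁)
      in walkIn-++ u⇝ (walkIn-++ (inside false a′ b′) ⇝v)
    connected-avoiding (inj₂ c) (inj₂ a) (inj₂ b) u≢x v≢x =
      let (a′ , u⇝) = leave false (u≢x ∘ cong inj₂); (b′ , ⇝v) = arrive false (v≢x ∘ cong inj₂)
      in walkIn-++ u⇝ (walkIn-++ (inside true a′ b′) ⇝v)
    connected-avoiding (inj₂ c) (inj₁ a) (inj₁ b) _ _ = inside true a b
    connected-avoiding (inj₁ c) (inj₂ a) (inj₂ b) _ _ = inside false a b
    connected-avoiding (inj₁ c) (inj₁ a) (inj₂ b) u≢x _ =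
      let (a′ , u⇝) = leave true (u≢x ∘ cong inj₁) in walkIn-++ u⇝ (inside false a′ b)
    connected-avoiding (inj₂ c) (inj₂ a) (inj₁ b) u≢x _ =
      let (a′ , u⇝) = leave false (u≢x ∘ cong inj₂) in walkIn-++ u⇝ (inside true a′ b)
    connected-avoiding (inj₂ c) (inj₁ a) (inj₂ b) _ v≢x =
      let (b′ , ⇝v) = arrive false (v≢x ∘ cong inj₂) in walkIn-++ (inside true a b′) ⇝v
    connected-avoiding (inj₁ c) (inj₂ a) (inj₁ b) _ v≢x =
      let (b′ , ⇝v) = arrive true (v≢x ∘ cong inj₁) in walkIn-++ (inside false a b′) ⇝v

    splitAt-≢ : ∀ {u x : Fin (k + k)} → u ≢ x → splitAt k u ≢ splitAt k x
    splitAt-≢ {u} {x} u≢x eq = u≢x (trans (sym (join-splitAt k k u)) (trans (cong (join k k) eq) (join-splitAt k k x)))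

  twin-strongly2Connected : Strongly2Connected G
  twin-strongly2Connected = s≤s (s≤s (s≤s z≤n)) , λ x u v u≢x v≢x →
    walkIn-map (λ w≢x → w≢x ∘ cong (splitAt k))
      (subst₂ (WalkIn G (Avoid (splitAt k x))) (join-splitAt k k u) (join-splitAt k k v)
        (connected-avoiding (splitAt k x) (splitAt k u) (splitAt k v) (splitAt-≢ u≢x) (splitAt-≢ v≢x)))

OnSide : ∀ {k} → Bool → Fin k ⊎ Fin k → Set
OnSide true  (inj₁ _) = ⊤
OnSide true  (inj₂ _) = ⊥
OnSide false (inj₁ _) = ⊥
OnSide false (inj₂ _) = ⊤

onSide-view : ∀ {k} s (v : Fin k ⊎ Fin k) → OnSide s v → ∃ λ a → v ≡ onSide s a
onSide-view true  (inj₁ a) _ = a , refl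
onSide-view false (inj₂ a) _ = a , refl

module _ {r : ℕ} {h : ℕ → ℕ → Bool} (τ : Fin (3 + r) ⊎ Fin (3 + r) → Fin (3 + r) ⊎ Fin (3 + r))
         (τ-edge : ∀ y → twinEdge h y (τ y) ≡ true) (orbit : SingleOrbit τ) where

  private
    V = Fin (3 + r) ⊎ Fin (3 + r)

    stays : ∀ s a → OnSide s (τ (onSide s (suc (suc a))))
    stays true a with τ (inj₁ (suc (suc a))) | τ-edge (inj₁ (suc (suc a)))
    ... | inj₁ _ | _  = tt
    ... | inj₂ _ | ()
    stays false a with τ (inj₂ (suc (suc a))) | τ-edge (inj₂ (suc (suc a)))
    ... | inj₂ _ | _  = tt
    ... | inj₁ _ | ()

    leaves : ∀ s i → OnSide s (τ (onSide s (port i))) ⊎ τ (onSide s (port i)) ≡ onSide (not s) (port (exitPort s i))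
    leaves true zero with τ (inj₁ zero) | τ-edge (inj₁ zero)
    ... | inj₁ _       | _  = inj₁ tt
    ... | inj₂ zero    | _  = inj₂ refl
    ... | inj₂ (suc _) | ()
    leaves true (suc zero) with τ (inj₁ (suc zero)) | τ-edge (inj₁ (suc zero))
    ... | inj₁ _             | _  = inj₁ tt
    ... | inj₂ (suc zero)    | _  = inj₂ refl
    ... | inj₂ zero          | ()
    ... | inj₂ (suc (suc _)) | ()
    leaves false zero with τ (inj₂ zero) | τ-edge (inj₂ zero)
    ... | inj₂ _             | _  = inj₁ tt
    ... | inj₁ (suc zero)    | _  = inj₂ refl
    ... | inj₁ zero          | ()
    ... | inj₁ (suc (suc _)) | ()
    leaves false (suc zero) with τ (inj₂ (suc zero)) | τ-edge (inj₂ (suc zero))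
    ... | inj₂ _       | _  = inj₁ tt
    ... | inj₁ zero    | _  = inj₂ refl
    ... | inj₁ (suc _) | ()

    -- If the ports of copy s lead only into copy s or to y, and y leads back into copy s,
    -- then copy s together with y is closed under τ.
    trapped : ∀ s y z → ¬ OnSide s z → z ≢ y →
              (∀ i → OnSide s (τ (onSide s (port i))) ⊎ τ (onSide s (port i)) ≡ y) → OnSide s (τ y) → ⊥
    trapped s y z z∉s z≢y ports τy∈s = [ z∉s , z≢y ] (orbit X closed y (inj₂ refl) z)
      where
      X : V → Set
      X v = OnSide s v ⊎ v ≡ y
      closed : ∀ v → X v → X (τ v)
      closed v (inj₂ refl) = inj₁ τy∈s
      closed v (inj₁ v∈s) with onSide-view s v v∈s
      ... | zero , refl          = ports zero
      ... | suc zero , refl      = ports (suc zero)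
      ... | suc (suc a) , refl   = inj₁ (stays s a)

    Port : V → Set
    Port (inj₁ a) = toℕ a < 2
    Port (inj₂ a) = toℕ a < 2

    all-cross : (∀ s i → τ (onSide s (port i)) ≡ onSide (not s) (port (exitPort s i))) → ⊥
    all-cross cross with orbit Port closed (inj₁ zero) (s≤s z≤n) (inj₁ (suc (suc zero)))
      where
      closed : ∀ v → Port v → Port (τ v)
      closed (inj₁ zero)       _ rewrite cross true zero        = s≤s z≤n
      closed (inj₁ (suc zero)) _ rewrite cross true (suc zero)  = s≤s (s≤s z≤n)
      closed (inj₂ zero)       _ rewrite cross false zero       = s≤s (s≤s z≤n)
      closed (inj₂ (suc zero)) _ rewrite cross false (suc zero) = s≤s z≤n
      closed (inj₁ (suc (suc a))) (s≤s (s≤s ()))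
      closed (inj₂ (suc (suc a))) (s≤s (s≤s ()))
    ... | s≤s (s≤s ())

  no-spanning-orbit : ⊥
  no-spanning-orbit with leaves true zero | leaves true (suc zero) | leaves false zero | leaves false (suc zero)
  ... | inj₁ a₀ | inj₁ a₁ | _       | _       =
    trapped true (inj₁ zero) (inj₂ zero) (λ ()) (λ ()) (λ { zero → inj₁ a₀ ; (suc zero) → inj₁ a₁ }) a₀
  ... | _       | _       | inj₁ b₀ | inj₁ b₁ =
    trapped false (inj₂ zero) (inj₁ zero) (λ ()) (λ ()) (λ { zero → inj₁ b₀ ; (suc zero) → inj₁ b₁ }) b₀
  ... | inj₂ a₀ | inj₁ a₁ | inj₂ b₀ | _       =
    trapped true (inj₂ zero) (inj₂ (suc zero)) (λ ()) (λ ())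
            (λ { zero → inj₂ a₀ ; (suc zero) → inj₁ a₁ }) (subst (OnSide true) (sym b₀) tt)
  ... | inj₂ a₀ | inj₁ _  | inj₁ b₀ | b₁      =
    trapped false (inj₁ zero) (inj₁ (suc zero)) (λ ()) (λ ())
            (λ { zero → inj₁ b₀ ; (suc zero) → b₁ }) (subst (OnSide false) (sym a₀) tt)
  ... | inj₁ a₀ | inj₂ a₁ | _       | inj₂ b₁ =
    trapped true (inj₂ (suc zero)) (inj₂ zero) (λ ()) (λ ())
            (λ { zero → inj₁ a₀ ; (suc zero) → inj₂ a₁ }) (subst (OnSide true) (sym b₁) tt)
  ... | inj₁ _  | inj₂ a₁ | b₀      | inj₁ b₁ =
    trapped false (inj₁ (suc zero)) (inj₁ zero) (λ ()) (λ ())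
            (λ { zero → b₀ ; (suc zero) → inj₁ b₁ }) (subst (OnSide false) (sym a₁) tt)
  ... | inj₂ a₀ | inj₂ a₁ | inj₂ b₀ | inj₂ b₁ =
    all-cross λ { true zero → a₀ ; true (suc zero) → a₁ ; false zero → b₀ ; false (suc zero) → b₁ }
  ... | inj₂ _  | inj₂ a₁ | inj₂ b₀ | inj₁ b₁ =
    trapped false (inj₁ (suc zero)) (inj₁ zero) (λ ()) (λ ())
            (λ { zero → inj₂ b₀ ; (suc zero) → inj₁ b₁ }) (subst (OnSide false) (sym a₁) tt)
  ... | inj₂ a₀ | inj₂ _  | inj₁ b₀ | inj₂ b₁ =
    trapped false (inj₁ zero) (inj₁ (suc zero)) (λ ()) (λ ())
            (λ { zero → inj₁ b₀ ; (suc zero) → inj₂ b₁ }) (subst (OnSide false) (sym a₀) tt)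

twin-nonHamiltonian : ∀ r (h : ℕ → ℕ → Bool) irreflexive → ¬ HamiltonCycle (twin r h irreflexive)
twin-nonHamiltonian r h irreflexive H with hamiltonCycle⇒successor (twin r h irreflexive) H
... | σ , σ-edge , σ-orbit =
  no-spanning-orbit τ τ-edge (singleOrbit-conj (splitAt k) (join k k) (join-splitAt k k) (splitAt-join k k) σ-orbit)
  where
  k = 3 + r
  τ = splitAt k ∘ σ ∘ join k k
  τ-edge : ∀ y → twinEdge h y (τ y) ≡ true
  τ-edge y = subst (λ x → twinEdge h x (τ y) ≡ true) (splitAt-join k k y) (σ-edge (join k k y))

twinOf : ∀ {r d h} → Gadget r d h → Digraph ((3 + r) + (3 + r))
twinOf {r} {h = h} g = twin r h (Gadget.irreflexive g)

twinOf-properties : ∀ {r d h} (g : Gadget r d h) →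
                    Strongly2Connected (twinOf g) × Regular d (twinOf g) × ¬ HamiltonCycle (twinOf g)
twinOf-properties {r} {h = h} g =
  twin-strongly2Connected g , twin-regular g , twin-nonHamiltonian r h (Gadget.irreflexive g)

nearlyComplete : ℕ → ℕ → Bool
nearlyComplete 0             j = 2 ≤ᵇ j
nearlyComplete 1             j = 2 ≤ᵇ j
nearlyComplete (suc (suc i)) j = not (suc (suc i) ≡ᵇ j)

nearlyComplete-gadget : ∀ q → Gadget q (2 + q) nearlyComplete
nearlyComplete-gadget q = record
  { irreflexive = irreflexive
  ; out-degree  = out-degree
  ; in-degree   = in-degree
  ; to-port     = to-port
  ; from-port   = from-port
  ; port₀⇝port₁ = step (s≤s z≤n) refl (step 2<n refl (here (s≤s (s≤s z≤n))))
  ; port₁⇝port₀ = step (s≤s (s≤s z≤n)) refl (step 2<n refl (here (s≤s z≤n)))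
  }
  where
  n = 3 + q
  h = nearlyComplete

  2<n : 2 < n
  2<n = s≤s (s≤s (s≤s z≤n))

  irreflexive : ∀ i → h i i ≡ false
  irreflexive 0             = refl
  irreflexive 1             = refl
  irreflexive (suc (suc i)) = cong not (≡ᵇ-true i)

  port-degree : count (λ j → 2 ≤ᵇ j) n + 1 ≡ 2 + q
  port-degree = trans (cong (_+ 1) (count-all (suc q) _ (λ _ _ → refl))) (+-comm (suc q) 1)

  out-degree : ∀ i → i < n → count (h i) n + boolToℕ (i <ᵇ 2) ≡ 2 + q
  out-degree 0             _   = port-degree
  out-degree 1             _   = port-degree
  out-degree (suc (suc i)) i<n = trans (+-identityʳ _) (suc-injective
    (count-all-but n (2 + i) (h (2 + i)) i<n (cong not (≡ᵇ-true i))
                   (λ j _ j≢i → cong not (≡ᵇ-false (j≢i ∘ sym)))))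

  in-degree : ∀ j → j < n → count (λ i → h i j) n + boolToℕ (j <ᵇ 2) ≡ 2 + q
  in-degree 0             _   = port-degree
  in-degree 1             _   = port-degree
  in-degree (suc (suc j)) j<n = trans (+-identityʳ _) (suc-injective
    (count-all-but n (2 + j) (λ i → h i (2 + j)) j<n (cong not (≡ᵇ-true j)) others))
    where
    others : ∀ i → i < n → i ≢ 2 + j → h i (2 + j) ≡ true
    others 0             _ _   = refl
    others 1             _ _   = refl
    others (suc (suc i)) _ i≢j = cong not (≡ᵇ-false i≢j)

  to-port : ∀ x u → u < n → u ≢ x → Σ (Fin 2) λ i → toℕ i ≢ x × Walk h (Avoiding n x) u (toℕ i)
  to-port x 0 u<n u≢x = zero , u≢x , here (u<n , u≢x)
  to-port x 1 u<n u≢x = suc zero , u≢x , here (u<n , u≢x)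
  to-port x (suc (suc u)) u<n u≢x with x ≟ 0
  ... | yes refl = suc zero , (λ ()) , step (u<n , u≢x) refl (here (s≤s (s≤s z≤n) , λ ()))
  ... | no x≢0   = zero , x≢0 ∘ sym , step (u<n , u≢x) refl (here (s≤s z≤n , x≢0 ∘ sym))

  from-port : ∀ x v → v < n → v ≢ x → Σ (Fin 2) λ i → toℕ i ≢ x × Walk h (Avoiding n x) (toℕ i) v
  from-port x 0 v<n v≢x = zero , v≢x , here (v<n , v≢x)
  from-port x 1 v<n v≢x = suc zero , v≢x , here (v<n , v≢x)
  from-port x (suc (suc v)) v<n v≢x with x ≟ 0
  ... | yes refl = suc zero , (λ ()) , step (s≤s (s≤s z≤n) , λ ()) refl (here (v<n , v≢x))
  ... | no x≢0   = zero , x≢0 ∘ sym , step (s≤s z≤n , x≢0 ∘ sym) refl (here (v<n , v≢x))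

+-suc² : ∀ m n → m + (2 + n) ≡ 2 + (m + n)
+-suc² m n = trans (+-suc m (suc n)) (cong suc (+-suc m n))

-- i → i + 1, …, i + e modulo 3 + 2e: an e-regular oriented graph on 3 + 2e vertices.
circulant : ℕ → ℕ → ℕ → Bool
circulant e i j = ((i <ᵇ j) ∧ (j <ᵇ i + suc e)) ∨ (j + (2 + e) <ᵇ i)

module _ {e : ℕ} where

  circulant-true : ∀ {i j} → (i < j × j < i + suc e) ⊎ (j + (2 + e) < i) → circulant e i j ≡ true
  circulant-true (inj₁ (i<j , j<i+e+1)) rewrite <ᵇ-true i<j | <ᵇ-true j<i+e+1 = refl
  circulant-true (inj₂ wrap)            rewrite <ᵇ-true wrap = ∨-zeroʳ _

  circulant-false : ∀ {i j} → ¬ (i < j × j < i + suc e) → i ≤ j + (2 + e) → circulant e i j ≡ false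
  circulant-false {i} {j} ¬forward no-wrap
    rewrite ∧-false (<ᵇ⇒< i j) (<ᵇ⇒< j (i + suc e)) ¬forward | <ᵇ-false no-wrap = refl

  private
    K = 3 + (e + e)
    L = 2 + (e + e)

  circulant-row-rotate : ∀ i → i < L → circulant e (suc i) 0 ≡ circulant e i L
  circulant-row-rotate i i<L with i <? 2 + e
  ... | yes i<2+e = trans (<ᵇ-false i<2+e) (sym (circulant-false ¬forward (≤-trans (<⇒≤ i<L) (m≤m+n L (2 + e)))))
    where
    ¬forward : ¬ (i < L × L < i + suc e)
    ¬forward (_ , L<) = <⇒≱ (+-monoˡ-< e i<2+e) (≤-pred (subst (L <_) (+-suc i e) L<))
  ... | no  i≮2+e =
    trans (<ᵇ-true (s≤s 2+e≤i))
          (sym (circulant-true (inj₁ (i<L , subst (L <_) (sym (+-suc i e)) (s≤s (+-monoˡ-≤ e 2+e≤i))))))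
    where
    2+e≤i = ≮⇒≥ i≮2+e

  circulant-column-rotate : ∀ j → j < L → circulant e 0 (suc j) ≡ circulant e L j
  circulant-column-rotate j j<L with suc j ≤? e
  ... | yes j<e = trans (circulant-true (inj₁ (s≤s z≤n , s≤s j<e)))
                          (sym (circulant-true (inj₂ (subst (_< L) (sym (+-suc² j e)) (s≤s (s≤s (+-monoˡ-< e j<e)))))))
  ... | no  j≮e = trans (circulant-false (λ (_ , j<e) → j≮e (≤-pred j<e)) z≤n)
                          (sym (circulant-false (λ (L<j , _) → <⇒≱ j<L (<⇒≤ L<j))
                                                (subst (L ≤_) (sym (+-suc² j e)) (s≤s (s≤s (+-monoˡ-≤ e (≮⇒≥ j≮e)))))))

  -- circulant e (1 + i) (1 + j) reduces to circulant e i j, so rotating reduces every row and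
  -- column count to that of row or column 0.
  circulant-row : ∀ i → i < K → count (circulant e i) K ≡ e
  circulant-row zero _ =
    count-window K 1 e (circulant e 0) (s≤s (≤-trans (m≤m+n e e) (m≤n+m (e + e) 2))) below inside above
    where
    below : ∀ j → j < 1 → circulant e 0 j ≡ false
    below zero _ = refl
    below (suc j) (s≤s ())
    inside : ∀ j → 1 ≤ j → j < 1 + e → circulant e 0 j ≡ true
    inside j 1≤j j<1+e = circulant-true (inj₁ (1≤j , j<1+e))
    above : ∀ j → 1 + e ≤ j → j < K → circulant e 0 j ≡ false
    above j 1+e≤j _ = circulant-false (λ (_ , j<1+e) → <⇒≱ j<1+e 1+e≤j) z≤n
  circulant-row (suc i) i+1<K =
    trans (count-rotate L (circulant e i) (circulant e (suc i)) (circulant-row-rotate i (≤-pred i+1<K)) (λ _ _ → refl))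
          (circulant-row i (<⇒≤ i+1<K))

  circulant-column : ∀ j → j < K → count (λ i → circulant e i j) K ≡ e
  circulant-column zero _ = count-window K (3 + e) e (λ i → circulant e i 0) ≤-refl below inside above
    where
    below : ∀ i → i < 3 + e → circulant e i 0 ≡ false
    below i i<3+e = <ᵇ-false (≤-pred i<3+e)
    inside : ∀ i → 3 + e ≤ i → i < 3 + e + e → circulant e i 0 ≡ true
    inside i 3+e≤i _ = circulant-true {i} {0} (inj₂ 3+e≤i)
    above : ∀ i → 3 + e + e ≤ i → i < K → circulant e i 0 ≡ false
    above i K≤i i<K = ⊥-elim (<⇒≱ i<K K≤i)
  circulant-column (suc j) j+1<K =
    trans (count-rotate L (λ i → circulant e i j) (λ i → circulant e i (suc j))
                        (circulant-column-rotate j (≤-pred j+1<K)) (λ _ _ → refl))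
          (circulant-column j (<⇒≤ j+1<K))

  circulant-true⁻¹ : ∀ {i j} → circulant e i j ≡ true → (i < j × j < i + suc e) ⊎ (j + (2 + e) < i)
  circulant-true⁻¹ {i} {j} c≡true =
    Sum.map (Product.map (<ᵇ⇒< i j) (<ᵇ⇒< j (i + suc e)) ∘ Equivalence.to T-∧) (<ᵇ⇒< (j + (2 + e)) i)
            (Equivalence.to T-∨ (Equivalence.from T-≡ c≡true))

  circulant-antisym : ∀ {i j} → circulant e i j ≡ true → circulant e j i ≡ false
  circulant-antisym {i} {j} c≡true with circulant-true⁻¹ c≡true
  ... | inj₁ (i<j , j<i+e+1) =
    circulant-false (λ (j<i , _) → <-asym i<j j<i) (≤-trans (<⇒≤ j<i+e+1) (+-monoʳ-≤ i (n≤1+n (suc e))))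
  ... | inj₂ wrap =
    circulant-false (λ (_ , i<j+e+1) → <-asym wrap (<-≤-trans i<j+e+1 (+-monoʳ-≤ j (n≤1+n (suc e)))))
                    (≤-trans (<⇒≤ (≤-trans (s≤s (m≤m+n j (2 + e))) wrap)) (m≤m+n i (2 + e)))

isPair : ℕ → ℕ → ℕ → ℕ → Bool
isPair a b i j = (i ≡ᵇ a) ∧ (j ≡ᵇ b)

isPair-false : ∀ {a b i j} → i ≢ a ⊎ j ≢ b → isPair a b i j ≡ false
isPair-false             (inj₁ i≢a) rewrite ≡ᵇ-false i≢a = refl
isPair-false {a} {b} {i} (inj₂ j≢b) rewrite ≡ᵇ-false j≢b = ∧-zeroʳ (i ≡ᵇ a)

isPair-true⁻¹ : ∀ {a b i j} → isPair a b i j ≡ true → i ≡ a × j ≡ b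
isPair-true⁻¹ {a} {b} {i} {j} eq =
  Product.map (≡ᵇ⇒≡ i a) (≡ᵇ⇒≡ j b) (Equivalence.to T-∧ (Equivalence.from T-≡ eq))

-- Moving 4 + e → 0 to 4 + e → 2 and deleting 0 → 1 and 1 → 2 costs the ports one in- and one
-- out-neighbour each and keeps the graph oriented.
rewired : ℕ → ℕ → ℕ → Bool
rewired e i j = (circulant e i j ∧ not (isPair 0 1 i j ∨ isPair 1 2 i j ∨ isPair (4 + e) 0 i j)) ∨ isPair (4 + e) 2 i j

module _ (p : ℕ) where
  private
    e = 2 + p
    K = 3 + (e + e)
    pivot = 4 + e
    h = rewired e

  rewired-agrees : ∀ i j → i ≢ 0 ⊎ j ≢ 1 → i ≢ 1 ⊎ j ≢ 2 → i ≢ pivot ⊎ j ≢ 0 → i ≢ pivot ⊎ j ≢ 2 →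
                   h i j ≡ circulant e i j
  rewired-agrees i j n01 n12 nd0 nd2
    rewrite isPair-false n01 | isPair-false n12 | isPair-false nd0 | isPair-false nd2 =
    trans (∨-identityʳ _) (∧-identityʳ _)

  rewired-false : ∀ {i j} → circulant e i j ≡ false → i ≢ pivot ⊎ j ≢ 2 → h i j ≡ false
  rewired-false c≡false nd2 rewrite c≡false | isPair-false nd2 = refl

  rewired-true⁻¹ : ∀ {i j} → h i j ≡ true → circulant e i j ≡ true ⊎ (i ≡ pivot × j ≡ 2)
  rewired-true⁻¹ {i} {j} h≡true with circulant e i j in c≡
  ... | true  = inj₁ refl
  ... | false = inj₂ (isPair-true⁻¹ h≡true)

  rewired-pivot-0 : h pivot 0 ≡ false
  rewired-pivot-0 rewrite ≡ᵇ-true pivot = trans (∨-identityʳ _) (∧-zeroʳ _)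

  rewired-pivot-2 : h pivot 2 ≡ true
  rewired-pivot-2 rewrite ≡ᵇ-true pivot = ∨-zeroʳ _

  private
    2<K : 2 < K
    2<K = s≤s (s≤s (s≤s z≤n))

    pivot<K : pivot < K
    pivot<K = s≤s (s≤s (s≤s (s≤s (s≤s (m≤n+m e p)))))

    circulant-pivot-0 : circulant e pivot 0 ≡ true
    circulant-pivot-0 = circulant-true {e} {pivot} {0} (inj₂ (s≤s (n≤1+n _)))

    circulant-pivot-2 : circulant e pivot 2 ≡ false
    circulant-pivot-2 = circulant-false {e} {pivot} {2} (λ (pivot<2 , _) → <⇒≱ pivot<2 (s≤s (s≤s z≤n))) ≤-refl

    circulant-2-pivot : circulant e 2 pivot ≡ false
    circulant-2-pivot = circulant-false {e} {2} {pivot} (λ (_ , pivot<3+e) → <⇒≱ pivot<3+e (n≤1+n _)) (s≤s (s≤s z≤n))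

    one-fewer : ∀ {c} {c′} → c ≡ suc c′ → c ≡ e → c′ + 1 ≡ e
    one-fewer {c′ = c′} c≡ c≡e = trans (+-comm c′ 1) (trans (sym c≡) c≡e)

  rewired-out-degree : ∀ i → i < K → count (h i) K + boolToℕ (i <ᵇ 2) ≡ e
  rewired-out-degree 0 i<K = one-fewer
    (count-insert K 1 (circulant e 0) (h 0) (s≤s (s≤s z≤n)) refl refl
      (λ j _ j≢1 → sym (rewired-agrees 0 j (inj₂ j≢1) (inj₁ λ ()) (inj₁ λ ()) (inj₁ λ ()))))
    (circulant-row 0 i<K)
  rewired-out-degree 1 i<K = one-fewer
    (count-insert K 2 (circulant e 1) (h 1) 2<K refl refl
      (λ j _ j≢2 → sym (rewired-agrees 1 j (inj₁ λ ()) (inj₂ j≢2) (inj₁ λ ()) (inj₁ λ ()))))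
    (circulant-row 1 i<K)
  rewired-out-degree (suc (suc i)) i<K with suc (suc i) ≟ pivot
  ... | yes refl = trans (+-identityʳ _) (trans (sym
    (count-move K 0 2 (circulant e pivot) (h pivot) (s≤s z≤n) 2<K circulant-pivot-0 rewired-pivot-0 circulant-pivot-2 rewired-pivot-2
      (λ j _ j≢0 j≢2 → sym (rewired-agrees pivot j (inj₁ λ ()) (inj₁ λ ()) (inj₂ j≢0) (inj₂ j≢2)))))
    (circulant-row pivot i<K))
  ... | no i≢pivot = trans (+-identityʳ _) (trans
    (count-cong K (λ j _ → rewired-agrees (suc (suc i)) j (inj₁ λ ()) (inj₁ λ ()) (inj₁ i≢pivot) (inj₁ i≢pivot)))
    (circulant-row (suc (suc i)) i<K))

  rewired-in-degree : ∀ j → j < K → count (λ i → h i j) K + boolToℕ (j <ᵇ 2) ≡ e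
  rewired-in-degree 0 j<K = one-fewer
    (count-insert K pivot (λ i → circulant e i 0) (λ i → h i 0) pivot<K circulant-pivot-0 rewired-pivot-0
      (λ i _ i≢pivot → sym (rewired-agrees i 0 (inj₂ λ ()) (inj₂ λ ()) (inj₁ i≢pivot) (inj₂ λ ()))))
    (circulant-column 0 j<K)
  rewired-in-degree 1 j<K = one-fewer
    (count-insert K 0 (λ i → circulant e i 1) (λ i → h i 1) (s≤s z≤n) refl refl
      (λ i _ i≢0 → sym (rewired-agrees i 1 (inj₁ i≢0) (inj₂ λ ()) (inj₂ λ ()) (inj₂ λ ()))))
    (circulant-column 1 j<K)
  rewired-in-degree 2 j<K = trans (+-identityʳ _) (trans (sym
    (count-move K 1 pivot (λ i → circulant e i 2) (λ i → h i 2) (s≤s (s≤s z≤n)) pivot<K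
                refl refl circulant-pivot-2 rewired-pivot-2
      (λ i _ i≢1 i≢pivot → sym (rewired-agrees i 2 (inj₂ λ ()) (inj₁ i≢1) (inj₂ λ ()) (inj₁ i≢pivot)))))
    (circulant-column 2 j<K))
  rewired-in-degree (suc (suc (suc j))) j<K = trans (+-identityʳ _) (trans
    (count-cong K (λ i _ → rewired-agrees i (3 + j) (inj₂ λ ()) (inj₂ λ ()) (inj₂ λ ()) (inj₂ λ ())))
    (circulant-column (3 + j) j<K))

  rewired-irreflexive : ∀ i → h i i ≡ false
  rewired-irreflexive i =
    rewired-false {i} {i} (circulant-false (λ (i<i , _) → <-irrefl refl i<i) (m≤m+n i (2 + e))) i≢pivot⊎i≢2
    where
    i≢pivot⊎i≢2 : i ≢ pivot ⊎ i ≢ 2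
    i≢pivot⊎i≢2 with i ≟ 2
    ... | yes refl = inj₁ (λ ())
    ... | no  i≢2  = inj₂ i≢2

  rewired-antisym : ∀ i j → h i j ≡ true → h j i ≡ false
  rewired-antisym i j h≡true with rewired-true⁻¹ {i} {j} h≡true
  ... | inj₂ (refl , refl) = rewired-false {2} {pivot} circulant-2-pivot (inj₁ λ ())
  ... | inj₁ c≡true        = rewired-false {j} {i} (circulant-antisym {e} {i} {j} c≡true) j≢pivot⊎i≢2
    where
    j≢pivot⊎i≢2 : j ≢ pivot ⊎ i ≢ 2
    j≢pivot⊎i≢2 with i ≟ 2
    ... | yes refl = inj₁ λ { refl → contradiction (trans (sym c≡true) circulant-2-pivot) λ () }
    ... | no  i≢2  = inj₂ i≢2

  private
    forward-edge : ∀ a j → 2 ≤ a → a < j → j ≤ 2 + a → h a j ≡ true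
    forward-edge a j 2≤a a<j j≤2+a =
      trans (rewired-agrees a j (inj₁ (λ { refl → <⇒≱ 2≤a z≤n })) (inj₁ (λ { refl → <⇒≱ 2≤a (s≤s z≤n) }))
                                (inj₂ (λ { refl → <⇒≱ a<j z≤n })) (inj₂ (λ { refl → <⇒≱ a<j 2≤a })))
            (circulant-true {e} {a} {j} (inj₁ (a<j , j<a+e+1)))
      where
      j<a+e+1 : j < a + suc e
      j<a+e+1 = subst (j <_) (sym (+-suc a e))
                      (s≤s (≤-trans j≤2+a (≤-trans (≤-reflexive (+-comm 2 a)) (+-monoʳ-≤ a (m≤m+n 2 p)))))

    edge-to-1 : ∀ u → pivot ≤ u → h u 1 ≡ true
    edge-to-1 u pivot≤u =
      trans (rewired-agrees u 1 (inj₁ (λ { refl → <⇒≱ pivot≤u z≤n })) (inj₂ λ ()) (inj₂ λ ()) (inj₂ λ ()))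
            (circulant-true {e} {u} {1} (inj₂ pivot≤u))

    edge-to-0 : ∀ u → 3 + e ≤ u → u ≢ pivot → h u 0 ≡ true
    edge-to-0 u 3+e≤u u≢pivot = trans (rewired-agrees u 0 (inj₂ λ ()) (inj₂ λ ()) (inj₁ u≢pivot) (inj₂ λ ()))
                                   (circulant-true {e} {u} {0} (inj₂ 3+e≤u))

    3+e<K : 3 + e < K
    3+e<K = <-trans (n<1+n _) pivot<K

    3+e≢pivot : 3 + e ≢ pivot
    3+e≢pivot = <⇒≢ (n<1+n _)

    -- Walk rightwards by steps of one, jumping over x with a step of two.
    forward-by : ∀ {x} g a → 2 ≤ a → g + a < K → a ≢ x → g + a ≢ x → Walk h (Avoiding K x) a (g + a)
    forward-by zero a _ a<K a≢x _ = here (a<K , a≢x)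
    forward-by {x} (suc g) a 2≤a b<K a≢x b≢x with suc a ≟ x
    ... | no a+1≢x =
      step (a<K , a≢x) (forward-edge a (suc a) 2≤a ≤-refl (n≤1+n _))
           (subst (Walk h _ (suc a)) (+-suc g a)
                  (forward-by g (suc a) (m≤n⇒m≤1+n 2≤a) (subst (_< K) (sym (+-suc g a)) b<K) a+1≢x
                              (b≢x ∘ trans (sym (+-suc g a)))))
      where a<K = ≤-<-trans (m≤n+m a (suc g)) b<K
    forward-by (suc zero)    a _   _   _   b≢x | yes refl = contradiction refl b≢x
    forward-by (suc (suc g)) a 2≤a b<K a≢x b≢x | yes refl =
      step (a<K , a≢x) (forward-edge a (2 + a) 2≤a (m<n+m a (s≤s z≤n)) ≤-refl)
           (subst (Walk h _ (2 + a)) (+-suc² g a)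
                  (forward-by g (2 + a) (≤-trans 2≤a (m≤n+m a 2)) (subst (_< K) (sym (+-suc² g a)) b<K)
                              (<⇒≢ (≤-refl {2 + a}) ∘ sym) (b≢x ∘ trans (sym (+-suc² g a)))))
      where a<K = ≤-<-trans (m≤n+m a (suc (suc g))) b<K

    forward : ∀ {x} a b → 2 ≤ a → a ≤ b → b < K → a ≢ x → b ≢ x → Walk h (Avoiding K x) a b
    forward {x} a b 2≤a a≤b b<K a≢x b≢x =
      subst (Walk h _ a) (m∸n+n≡m a≤b) (forward-by (b ∸ a) a 2≤a (subst (_< K) (sym (m∸n+n≡m a≤b)) b<K) a≢x
                                                   (b≢x ∘ trans (sym (m∸n+n≡m a≤b))))

    1<K : 1 < K
    1<K = s≤s (s≤s z≤n)

    down-to-0 : ∀ {x} u → 2 ≤ u → u ≤ 3 + e → u ≢ x → 3 + e ≢ x → 0 ≢ x → Walk h (Avoiding K x) u 0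
    down-to-0 u 2≤u u≤3+e u≢x 3+e≢x 0≢x =
      walk-++ (forward u (3 + e) 2≤u u≤3+e 3+e<K u≢x 3+e≢x)
              (step (3+e<K , 3+e≢x) (edge-to-0 (3 + e) ≤-refl 3+e≢pivot) (here (s≤s z≤n , 0≢x)))

    down-to-1 : ∀ {x} u → 2 ≤ u → u ≤ pivot → u ≢ x → pivot ≢ x → 1 ≢ x → Walk h (Avoiding K x) u 1
    down-to-1 u 2≤u u≤pivot u≢x pivot≢x 1≢x =
      walk-++ (forward u pivot 2≤u u≤pivot pivot<K u≢x pivot≢x)
              (step (pivot<K , pivot≢x) (edge-to-1 pivot ≤-refl) (here (1<K , 1≢x)))

    up-from-0 : ∀ {x} v → 2 ≤ v → v < K → v ≢ x → 0 ≢ x → 2 ≢ x → Walk h (Avoiding K x) 0 v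
    up-from-0 v 2≤v v<K v≢x 0≢x 2≢x = step (s≤s z≤n , 0≢x) refl (forward 2 v ≤-refl 2≤v v<K 2≢x v≢x)

    up-from-1 : ∀ {x} v → 3 ≤ v → v < K → v ≢ x → 1 ≢ x → 3 ≢ x → Walk h (Avoiding K x) 1 v
    up-from-1 v 3≤v v<K v≢x 1≢x 3≢x = step (1<K , 1≢x) refl (forward 3 v (s≤s (s≤s z≤n)) 3≤v v<K 3≢x v≢x)

    3≤ : ∀ v → 2 + v ≢ 2 → 3 ≤ 2 + v
    3≤ zero    v≢0 = contradiction refl v≢0
    3≤ (suc v) _   = s≤s (s≤s (s≤s z≤n))

  rewired-to-port : ∀ x u → u < K → u ≢ x → Σ (Fin 2) λ i → toℕ i ≢ x × Walk h (Avoiding K x) u (toℕ i)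
  rewired-to-port x 0 u<K u≢x = zero , u≢x , here (u<K , u≢x)
  rewired-to-port x 1 u<K u≢x = suc zero , u≢x , here (u<K , u≢x)
  rewired-to-port x u@(suc (suc _)) u<K u≢x with x ≟ 1 | u ≤? 3 + e | u ≟ pivot | pivot ≤? u | x ≟ pivot
  ... | yes refl | yes u≤3+e | _        | _        | _        =
    zero , (λ ()) , down-to-0 u (s≤s (s≤s z≤n)) u≤3+e u≢x (λ ()) (λ ())
  ... | yes refl | no _      | yes refl | _        | _        =
    zero , (λ ()) , step (pivot<K , u≢x) rewired-pivot-2 (down-to-0 2 ≤-refl (s≤s (s≤s z≤n)) (λ ()) (λ ()) (λ ()))
  ... | yes refl | no u≰3+e  | no u≢pivot  | _        | _        =
    zero , (λ ()) , step (u<K , u≢x) (edge-to-0 u (<⇒≤ (≰⇒> u≰3+e)) u≢pivot) (here (s≤s z≤n , λ ()))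
  ... | no x≢1   | _         | _        | yes pivot≤u | _        =
    suc zero , x≢1 ∘ sym , step (u<K , u≢x) (edge-to-1 u pivot≤u) (here (1<K , x≢1 ∘ sym))
  ... | no _     | _         | _        | no pivot≰u  | yes refl =
    zero , (λ ()) , down-to-0 u (s≤s (s≤s z≤n)) (≤-pred (≰⇒> pivot≰u)) u≢x 3+e≢pivot (λ ())
  ... | no x≢1   | _         | _        | no pivot≰u  | no x≢pivot  =
    suc zero , x≢1 ∘ sym , down-to-1 u (s≤s (s≤s z≤n)) (<⇒≤ (≰⇒> pivot≰u)) u≢x (x≢pivot ∘ sym) (x≢1 ∘ sym)

  rewired-from-port : ∀ x v → v < K → v ≢ x → Σ (Fin 2) λ i → toℕ i ≢ x × Walk h (Avoiding K x) (toℕ i) v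
  rewired-from-port x 0 v<K v≢x = zero , v≢x , here (v<K , v≢x)
  rewired-from-port x 1 v<K v≢x = suc zero , v≢x , here (v<K , v≢x)
  rewired-from-port x v@(suc (suc v′)) v<K v≢x with x ≟ 0 | x ≟ 2 | v ≟ 2
  ... | yes refl | _        | yes refl =
    suc zero , (λ ()) , walk-++ (up-from-1 pivot (s≤s (s≤s (s≤s z≤n))) pivot<K (λ ()) (λ ()) (λ ()))
                                (step (pivot<K , λ ()) rewired-pivot-2 (here (s≤s (s≤s (s≤s z≤n)) , λ ())))
  ... | yes refl | _        | no v≢2   = suc zero , (λ ()) , up-from-1 v (3≤ v′ v≢2) v<K v≢x (λ ()) (λ ())
  ... | no _     | yes refl | _        = suc zero , (λ ()) , up-from-1 v (3≤ v′ v≢x) v<K v≢x (λ ()) (λ ())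
  ... | no x≢0   | no x≢2   | _        =
    zero , x≢0 ∘ sym , up-from-0 v (s≤s (s≤s z≤n)) v<K v≢x (x≢0 ∘ sym) (x≢2 ∘ sym)

  rewired-gadget : Gadget (e + e) e h
  rewired-gadget = record
    { irreflexive = rewired-irreflexive
    ; out-degree  = rewired-out-degree
    ; in-degree   = rewired-in-degree
    ; to-port     = rewired-to-port
    ; from-port   = rewired-from-port
    ; port₀⇝port₁ = step (s≤s z≤n) refl
                      (walk-map proj₁ (down-to-1 {0} 2 ≤-refl (s≤s (s≤s z≤n)) (λ ()) (λ ()) (λ ())))
    ; port₁⇝port₀ = step 1<K refl
                      (walk-map proj₁ (down-to-0 {1} 3 (s≤s (s≤s z≤n)) (s≤s (s≤s (s≤s z≤n))) (λ ()) (λ ()) (λ ())))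
    }

nonHamiltonian-digraph : (n : ℕ) → 3 ≤ n →
  Σ (Digraph (2 * n)) λ G → Strongly2Connected G × Regular (n ∸ 1) G × ¬ HamiltonCycle G
nonHamiltonian-digraph (suc (suc (suc q))) (s≤s (s≤s (s≤s _))) =
  subst (λ m → Σ (Digraph m) λ G → Strongly2Connected G × Regular (2 + q) G × ¬ HamiltonCycle G)
        (cong (3 + q +_) (sym (+-identityʳ (3 + q))))
        (twinOf g , twinOf-properties g)
  where g = nearlyComplete-gadget q

oriented-order : ∀ p → 3 + ((2 + p) + (2 + p)) + (3 + ((2 + p) + (2 + p))) ≡ 4 * (3 + p) + 2
oriented-order = solve-∀

nonHamiltonian-oriented : (n : ℕ) → 3 ≤ n →
  Σ (Digraph (4 * n + 2)) λ G → Oriented G × Strongly2Connected G × Regular (n ∸ 1) G × ¬ HamiltonCycle G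
nonHamiltonian-oriented (suc (suc (suc p))) (s≤s (s≤s (s≤s _))) =
  subst (λ m → Σ (Digraph m) λ G → Oriented G × Strongly2Connected G × Regular (2 + p) G × ¬ HamiltonCycle G)
        (oriented-order p)
        (twinOf g , twin-oriented (rewired-irreflexive p) (rewired-antisym p) , twinOf-properties g)
  where g = rewired-gadget p

proposition1p6 :
    ((n : ℕ) → 3 ≤ n →
      Σ (Digraph (2 * n)) λ G →
        Strongly2Connected G × Regular (n ∸ 1) G × ¬ HamiltonCycle G)
    ×
    ((n : ℕ) → 3 ≤ n →
      Σ (Digraph (4 * n + 2)) λ G →
        Oriented G × Strongly2Connected G × Regular (n ∸ 1) G × ¬ HamiltonCycle G)
proposition1p6 = nonHamiltonian-digraph , nonHamiltonian-oriented
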